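{- Let $G$ be a finite abelian group, let $H$ be a cyclic subgroup of $G$, let $\varphi\colon G\rightarrow G/H$ be the canonical epimorphism, and let $k\in\mathbb N$. If $S\in \mathcal M_k(G)$, then $\varphi(S)\in \mathcal M_{k|H|}(G/H)$.
   Context: A sequence over $G$ is a finite unordered sequence of elements of $G$ with repetition allowed; it is zero-sum if its terms sum to $0$. For a map $\varphi$, $\varphi(g_1\cdot\ldots\cdot g_l)=\varphi(g_1)\cdot\ldots\cdot\varphi(g_l)$. For $k\in\mathbb N$, $\mathcal M_k(G)$ is the set of zero-sum sequences over $G$ that cannot be partitioned into $k+1$ nontrivial zero-sum subsequences. -}

module Defs where

open import Level using (Level; _⊔_)
open import Algebra.Bundles using (AbelianGroup)
open import Algebra.Morphism.Structures using (module GroupMorphisms)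
open import Data.Nat using (ℕ; zero; suc; _≤_; _<_)
open import Data.Integer using (ℤ; +_; -[1+_])
open import Data.List using (List; []; _∷_; foldr; length; concat; map)
open import Data.List.Relation.Unary.All using (All)
open import Data.List.Relation.Unary.Any using (Any)
open import Data.List.Relation.Binary.Permutation.Propositional using (_↭_)
open import Data.Product using (Σ; ∃; _×_)
open import Relation.Binary.PropositionalEquality using (_≡_; _≢_)
open import Relation.Nullary using (¬_)
open import Function.Bundles using (_⇔_)

module _ {c ℓ : Level} (G : AbelianGroup c ℓ) where
  open AbelianGroup G

  -- the sum σ(S) of a sequence (sequences = lists, taken up to permutation)
  σ : List Carrier → Carrier
  σ = foldr _∙_ ε

  ZeroSum : List Carrier → Set ℓ
  ZeroSum S = σ S ≈ ε

  PartitionInto : ℕ → List Carrier → Set (c ⊔ ℓ)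
  PartitionInto m S =
    Σ (List (List Carrier)) λ Ts →
      (length Ts ≡ m) × (concat Ts ↭ S) × All (λ T → (T ≢ []) × ZeroSum T) Ts

  𝓜 : ℕ → List Carrier → Set (c ⊔ ℓ)
  𝓜 k S = ZeroSum S × ¬ PartitionInto (suc k) S

  IsFinite : Set (c ⊔ ℓ)
  IsFinite = Σ (List Carrier) λ xs → ∀ x → Any (x ≈_) xs

  _·ℕ_ : ℕ → Carrier → Carrier
  zero ·ℕ x = ε
  suc n ·ℕ x = x ∙ (n ·ℕ x)

  _·ℤ_ : ℤ → Carrier → Carrier
  (+ n) ·ℤ x = n ·ℕ x
  -[1+ n ] ·ℤ x = (suc n ·ℕ x) ⁻¹

  _∈⟨_⟩ : Carrier → Carrier → Set ℓ
  x ∈⟨ h ⟩ = ∃ λ (m : ℤ) → x ≈ (m ·ℤ h)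

  -- n = ord(h) = |⟨h⟩|
  IsOrder : Carrier → ℕ → Set ℓ
  IsOrder h n = (0 < n) × (n ·ℕ h ≈ ε) × (∀ m → 0 < m → m ·ℕ h ≈ ε → n ≤ m)

-- φ : G → Q is (up to isomorphism) the canonical epimorphism G → G/⟨h⟩:
-- a surjective group homomorphism whose kernel is exactly ⟨h⟩
record IsCanonicalEpi {c ℓ c' ℓ' : Level} (G : AbelianGroup c ℓ) (Q : AbelianGroup c' ℓ')
         (h : AbelianGroup.Carrier G) (φ : AbelianGroup.Carrier G → AbelianGroup.Carrier Q)
         : Set (c ⊔ ℓ ⊔ c' ⊔ ℓ') where
  open GroupMorphisms (AbelianGroup.rawGroup G) (AbelianGroup.rawGroup Q)
  field
    homo       : IsGroupHomomorphism φ
    surjective : ∀ y → ∃ λ x → AbelianGroup._≈_ Q (φ x) y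
    kernel     : ∀ x → (AbelianGroup._≈_ Q (φ x) (AbelianGroup.ε Q)) ⇔ (_∈⟨_⟩ G x h)

{-# OPTIONS --safe #-}
module Submission where

-- Lift a partition of φ(S) into kn + 1 nonempty zero-sum parts to a partition of S into kn + 1
-- parts Tᵢ with σ(Tᵢ) = aᵢ · h ∈ ⟨h⟩.  Among any n of these parts some consecutive run has
-- Σ aᵢ ≡ 0 (mod n) (pigeonhole on prefix sums), so its union is zero-sum in G.  Splitting off k
-- such runs of at most n parts each leaves a nonempty rest, which is zero-sum because S is; so S
-- splits into k + 1 nonempty zero-sum parts.

open import Level using (Level; _⊔_)
open import Function.Base using (_∘_)
open import Data.Nat.Base using (ℕ; zero; suc; _+_; _*_; _∸_; _≤_; _<_; NonZero; >-nonZero)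
open import Data.Nat.Properties
open import Data.Nat.DivMod using (_%_; _/_; _mod_; m≡m%n+[m/n]*n; m%n<n)
open import Data.Nat.Divisibility using (_∣_; divides; ∣m+n∣m⇒∣n; n∣m*n)
open import Data.Nat.ListAction using (sum)
open import Data.Nat.ListAction.Properties using (sum-++)
open import Data.Fin.Base using (toℕ)
open import Data.Fin.Properties using (pigeonhole; toℕ-fromℕ<; toℕ≤pred[n])
open import Data.List.Base using (List; []; _∷_; _++_; take; drop; length; map; concat; concatMap)
open import Data.List.Properties
  using (take++drop≡id; take-[]; length-take; length-drop; length-map; length-++; map-++; map-∘;
         ∷-injective; ++-conicalˡ; concat-concat; concat-map)
open import Data.List.Relation.Unary.All using (All; []; _∷_)
import Data.List.Relation.Unary.All as All
import Data.List.Relation.Unary.All.Properties as All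
open import Data.List.Relation.Binary.Permutation.Propositional
  using (_↭_; ↭-refl; ↭-sym; ↭-trans; ↭-reflexive; prep; swap; ↭⇒↭ₛ′)
import Data.List.Relation.Binary.Permutation.Propositional as ↭
open import Data.List.Relation.Binary.Permutation.Propositional.Properties
  using (shifts; ++⁺ˡ; ↭-length; ↭-map-inv)
  renaming (map⁺ to ↭-map⁺; ++-identityʳ to ↭-++-identityʳ)
open import Data.Product.Base using (∃; ∃₂; _×_; _,_; proj₂)
open import Data.Integer.Base using (+_; -[1+_])
open import Algebra.Bundles using (AbelianGroup)
open import Algebra.Morphism.Structures using (module GroupMorphisms)
open import Function.Bundles using (Equivalence)
import Algebra.Properties.Group as GroupProperties
import Relation.Binary.Reasoning.Setoid as SetoidReasoning
import Data.List.Relation.Binary.Permutation.Setoid.Properties as ↭ₛ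
open import Defs
open import Relation.Binary.PropositionalEquality
  using (_≡_; _≢_; refl; sym; trans; cong; subst; module ≡-Reasoning)

private
  variable
    ℓ₁ ℓ₂ : Level
    A : Set ℓ₁
    B : Set ℓ₂

take-+ : ∀ m d (xs : List A) → take (m + d) xs ≡ take m xs ++ take d (drop m xs)
take-+ zero    d xs       = refl
take-+ (suc m) d []       = sym (take-[] d)
take-+ (suc m) d (x ∷ xs) = cong (x ∷_) (take-+ m d xs)

concat⁺ : {xss yss : List (List A)} → xss ↭ yss → concat xss ↭ concat yss
concat⁺ ↭.refl         = ↭-refl
concat⁺ (prep xs p)    = ++⁺ˡ xs (concat⁺ p)
concat⁺ (swap xs ys p) = ↭-trans (shifts xs ys) (++⁺ˡ ys (++⁺ˡ xs (concat⁺ p)))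
concat⁺ (↭.trans p q)  = ↭-trans (concat⁺ p) (concat⁺ q)

<length-without-infix : ∀ {m n} (ys zs ws : List A) → length zs ≤ n →
                        n + m < length (ys ++ zs ++ ws) → m < length (ys ++ ws)
<length-without-infix {m = m} {n} ys zs ws ∣zs∣≤n len = +-cancelˡ-< n _ _ (begin-strict
  n + m                          <⟨ len ⟩
  length (ys ++ zs ++ ws)        ≡⟨ ↭-length (shifts ys zs) ⟩
  length (zs ++ ys ++ ws)        ≡⟨ length-++ zs ⟩
  length zs + length (ys ++ ws)  ≤⟨ +-monoˡ-≤ _ ∣zs∣≤n ⟩
  n + length (ys ++ ws)          ∎)
  where open ≤-Reasoning

concatMap-concat : ∀ (f : A → List B) xss → concatMap (concatMap f) xss ≡ concatMap f (concat xss)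
concatMap-concat f xss = begin
  concat (map (concat ∘ map f) xss)        ≡⟨ cong concat (map-∘ xss) ⟩
  concat (map concat (map (map f) xss))    ≡⟨ concat-concat (map (map f) xss) ⟩
  concat (concat (map (map f) xss))        ≡⟨ cong concat (concat-map xss) ⟩
  concat (map f (concat xss))              ∎
  where open ≡-Reasoning

module _ (f : A → B) where

  ++-≡-map-inv : ∀ (ys zs : List B) xs → ys ++ zs ≡ map f xs →
                 ∃₂ λ ys′ zs′ → ys ≡ map f ys′ × zs ≡ map f zs′ × xs ≡ ys′ ++ zs′
  ++-≡-map-inv []       zs xs       eq = [] , xs , refl , eq , refl
  ++-≡-map-inv (y ∷ ys) zs (x ∷ xs) eq
    with refl , eq′ ← ∷-injective eq
    with ys′ , zs′ , refl , refl , refl ← ++-≡-map-inv ys zs xs eq′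
    = x ∷ ys′ , zs′ , refl , refl , refl

  concat-≡-map-inv : ∀ (yss : List (List B)) xs → concat yss ≡ map f xs →
                     ∃ λ xss → yss ≡ map (map f) xss × concat xss ≡ xs
  concat-≡-map-inv []         []       refl = [] , refl , refl
  concat-≡-map-inv (ys ∷ yss) xs       eq
    with ys′ , zs′ , refl , eq′ , refl ← ++-≡-map-inv ys (concat yss) xs eq
    with xss , refl , refl ← concat-≡-map-inv yss zs′ eq′
    = ys′ ∷ xss , refl , refl

  concat-↭-map-inv : ∀ (yss : List (List B)) xs → concat yss ↭ map f xs →
                     ∃ λ xss → yss ≡ map (map f) xss × concat xss ↭ xs
  concat-↭-map-inv yss xs p
    with xs′ , eq , xs↭xs′ ← ↭-map-inv f (↭-sym p)
    with xss , refl , refl ← concat-≡-map-inv yss xs′ eq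
    = xss , refl , ↭-sym xs↭xs′

module _ (n : ℕ) .{{_ : NonZero n}} where

  m%n≡[m+d]%n⇒n∣d : ∀ m d → m % n ≡ (m + d) % n → n ∣ d
  m%n≡[m+d]%n⇒n∣d m d eq = ∣m+n∣m⇒∣n (subst (n ∣_) quotients (n∣m*n ((m + d) / n))) (n∣m*n (m / n))
    where
    open ≡-Reasoning
    quotients : (m + d) / n * n ≡ m / n * n + d
    quotients = +-cancelˡ-≡ (m % n) _ _ (begin
      m % n + (m + d) / n * n        ≡⟨ cong (_+ (m + d) / n * n) eq ⟩
      (m + d) % n + (m + d) / n * n  ≡⟨ m≡m%n+[m/n]*n (m + d) n ⟨
      m + d                          ≡⟨ cong (_+ d) (m≡m%n+[m/n]*n m n) ⟩
      m % n + m / n * n + d          ≡⟨ +-assoc (m % n) _ d ⟩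
      m % n + (m / n * n + d)        ∎)

  mod≡⇒%≡ : ∀ m o → m mod n ≡ o mod n → m % n ≡ o % n
  mod≡⇒%≡ m o eq = begin
    m % n          ≡⟨ toℕ-fromℕ< (m%n<n m n) ⟨
    toℕ (m mod n)  ≡⟨ cong toℕ eq ⟩
    toℕ (o mod n)  ≡⟨ toℕ-fromℕ< (m%n<n o n) ⟩
    o % n          ∎
    where open ≡-Reasoning

  module _ (f : A → ℕ) where

    divisible-infix : ∀ xs → n ≤ length xs →
      ∃₂ λ ys zs → ∃ λ ws → xs ≡ ys ++ zs ++ ws × zs ≢ [] × length zs ≤ n × n ∣ sum (map f zs)
    divisible-infix xs n≤∣xs∣
      with p , q , p<q , residues≡ ← pigeonhole (n<1+n n) (λ i → sum (map f (take (toℕ i) xs)) mod n)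
      = ys , zs , ws , xs≡ , zs≢[] , ∣zs∣≤n , n∣Σzs
      where
      i = toℕ p
      j = toℕ q
      d = j ∸ i
      ys = take i xs
      zs = take d (drop i xs)
      ws = drop d (drop i xs)

      xs≡ : xs ≡ ys ++ zs ++ ws
      xs≡ = sym (trans (cong (ys ++_) (take++drop≡id d (drop i xs))) (take++drop≡id i xs))

      j≤n : j ≤ n
      j≤n = toℕ≤pred[n] q

      d≤∣drop-i-xs∣ : d ≤ length (drop i xs)
      d≤∣drop-i-xs∣ = subst (d ≤_) (sym (length-drop i xs)) (∸-monoˡ-≤ i (≤-trans j≤n n≤∣xs∣))

      ∣zs∣≡d : length zs ≡ d
      ∣zs∣≡d = trans (length-take d (drop i xs)) (m≤n⇒m⊓n≡m d≤∣drop-i-xs∣)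

      zs≢[] : zs ≢ []
      zs≢[] zs≡[] = <⇒≢ (m<n⇒0<n∸m p<q) (trans (cong length (sym zs≡[])) ∣zs∣≡d)

      ∣zs∣≤n : length zs ≤ n
      ∣zs∣≤n = subst (_≤ n) (sym ∣zs∣≡d) (≤-trans (m∸n≤m j i) j≤n)

      prefix-sum-j : sum (map f (take j xs)) ≡ sum (map f ys) + sum (map f zs)
      prefix-sum-j = begin
        sum (map f (take j xs))        ≡⟨ cong (λ l → sum (map f (take l xs))) (m+[n∸m]≡n (<⇒≤ p<q)) ⟨
        sum (map f (take (i + d) xs))  ≡⟨ cong (sum ∘ map f) (take-+ i d xs) ⟩
        sum (map f (ys ++ zs))         ≡⟨ cong sum (map-++ f ys zs) ⟩
        sum (map f ys ++ map f zs)     ≡⟨ sum-++ (map f ys) (map f zs) ⟩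
        sum (map f ys) + sum (map f zs) ∎
        where open ≡-Reasoning

      n∣Σzs : n ∣ sum (map f zs)
      n∣Σzs = m%n≡[m+d]%n⇒n∣d _ _ (subst (λ s → _ ≡ s % n) prefix-sum-j (mod≡⇒%≡ _ _ residues≡))

    divisible-blocks : ∀ k xs → k * n < length xs →
      ∃₂ λ rest bs → length bs ≡ k × rest ++ concat bs ↭ xs × rest ≢ []
                   × All (λ b → b ≢ [] × n ∣ sum (map f b)) bs
    divisible-blocks zero xs 0<∣xs∣ =
      xs , [] , refl , ↭-++-identityʳ xs , (λ { refl → <-irrefl refl 0<∣xs∣ }) , []
    divisible-blocks (suc k) xs len
      with ys , zs , ws , refl , zs≢[] , ∣zs∣≤n , n∣Σzs
             ← divisible-infix xs (≤-trans (m≤m+n n (k * n)) (<⇒≤ len))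
      with rest , bs , ∣bs∣ , p , rest≢[] , blocks
             ← divisible-blocks k (ys ++ ws) (<length-without-infix ys zs ws ∣zs∣≤n len)
      = rest , zs ∷ bs , cong suc ∣bs∣ , p′ , rest≢[] , (zs≢[] , n∣Σzs) ∷ blocks
      where
      p′ : rest ++ zs ++ concat bs ↭ ys ++ zs ++ ws
      p′ = ↭-trans (shifts rest zs) (↭-trans (++⁺ˡ zs p) (shifts zs ys))

module _ {c ℓ : Level} (G : AbelianGroup c ℓ) where
  open AbelianGroup G
    using (Carrier; _≈_; _∙_; ε; setoid; isEquivalence; isCommutativeMonoid; group;
           ∙-cong; ∙-congˡ; identityˡ; identityʳ; assoc)
    renaming (refl to ≈-refl; sym to ≈-sym; trans to ≈-trans)
  open GroupProperties group using (inverseʳ-unique)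
  open SetoidReasoning setoid

  private
    infixr 8 _·_
    _·_ : ℕ → Carrier → Carrier
    _·_ = _·ℕ_ G

  ·-homo-+ : ∀ m d x → (m + d) · x ≈ m · x ∙ d · x
  ·-homo-+ zero    d x = ≈-sym (identityˡ (d · x))
  ·-homo-+ (suc m) d x = ≈-trans (∙-congˡ (·-homo-+ m d x)) (≈-sym (assoc x (m · x) (d · x)))

  σ-++ : ∀ xs ys → σ G (xs ++ ys) ≈ σ G xs ∙ σ G ys
  σ-++ []       ys = ≈-sym (identityˡ (σ G ys))
  σ-++ (x ∷ xs) ys = ≈-trans (∙-congˡ (σ-++ xs ys)) (≈-sym (assoc x (σ G xs) (σ G ys)))

  σ-↭ : ∀ {xs ys} → xs ↭ ys → σ G xs ≈ σ G ys
  σ-↭ = ↭ₛ.foldr-commMonoid setoid isCommutativeMonoid ∘ ↭⇒↭ₛ′ isEquivalence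

  zeroSum-concat : ∀ {xss} → All (ZeroSum G) xss → ZeroSum G (concat xss)
  zeroSum-concat []                       = ≈-refl
  zeroSum-concat {xs ∷ xss} (σxs≈ε ∷ zss) = begin
    σ G (xs ++ concat xss)        ≈⟨ σ-++ xs (concat xss) ⟩
    σ G xs ∙ σ G (concat xss)     ≈⟨ ∙-cong σxs≈ε (zeroSum-concat zss) ⟩
    ε ∙ ε                         ≈⟨ identityˡ ε ⟩
    ε                             ∎

  zeroSum-++⁻ˡ : ∀ xs {ys} → ZeroSum G (xs ++ ys) → ZeroSum G ys → ZeroSum G xs
  zeroSum-++⁻ˡ xs {ys} σxsys≈ε σys≈ε = begin
    σ G xs                ≈⟨ identityʳ (σ G xs) ⟨
    σ G xs ∙ ε            ≈⟨ ∙-congˡ σys≈ε ⟨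
    σ G xs ∙ σ G ys       ≈⟨ σ-++ xs ys ⟨
    σ G (xs ++ ys)        ≈⟨ σxsys≈ε ⟩
    ε                     ∎

  partitionInto-resp-↭ : ∀ {m xs ys} → xs ↭ ys → PartitionInto G m xs → PartitionInto G m ys
  partitionInto-resp-↭ xs↭ys (ts , ∣ts∣ , ts↭xs , zero-sum-parts) =
    ts , ∣ts∣ , ↭-trans ts↭xs xs↭ys , zero-sum-parts

  module _ (h : Carrier) where

    record Part : Set (c ⊔ ℓ) where
      field
        terms      : List Carrier
        nonempty   : terms ≢ []
        weight     : ℕ
        σ≈weight·h : σ G terms ≈ weight · h
    open Part

    flatten : List Part → List Carrier
    flatten = concatMap terms

    flatten-≢[] : ∀ {ps} → ps ≢ [] → flatten ps ≢ []
    flatten-≢[] {[]}     ps≢[] = λ _ → ps≢[] refl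
    flatten-≢[] {p ∷ ps} _     = nonempty p ∘ ++-conicalˡ (terms p) (flatten ps)

    flatten-↭ : ∀ {ps qs} → ps ↭ qs → flatten ps ↭ flatten qs
    flatten-↭ = concat⁺ ∘ ↭-map⁺ terms

    σ-flatten : ∀ ps → σ G (flatten ps) ≈ sum (map weight ps) · h
    σ-flatten []       = ≈-refl
    σ-flatten (p ∷ ps) = begin
      σ G (terms p ++ flatten ps)                ≈⟨ σ-++ (terms p) (flatten ps) ⟩
      σ G (terms p) ∙ σ G (flatten ps)           ≈⟨ ∙-cong (σ≈weight·h p) (σ-flatten ps) ⟩
      weight p · h ∙ sum (map weight ps) · h     ≈⟨ ·-homo-+ (weight p) (sum (map weight ps)) h ⟨
      (weight p + sum (map weight ps)) · h       ∎

    module _ (n : ℕ) .{{_ : NonZero n}} (n·h≈ε : n · h ≈ ε) where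

      ∣⇒·≈ε : ∀ {m} → n ∣ m → m · h ≈ ε
      ∣⇒·≈ε (divides q refl) = multiple q
        where
        multiple : ∀ q → (q * n) · h ≈ ε
        multiple zero    = ≈-refl
        multiple (suc q) = begin
          (n + q * n) · h        ≈⟨ ·-homo-+ n (q * n) h ⟩
          n · h ∙ (q * n) · h    ≈⟨ ∙-cong n·h≈ε (multiple q) ⟩
          ε ∙ ε                  ≈⟨ identityˡ ε ⟩
          ε                      ∎

      ∈⟨⟩⇒ℕ-multiple : ∀ {x} → _∈⟨_⟩ G x h → ∃ λ a → x ≈ a · h
      ∈⟨⟩⇒ℕ-multiple (+ a , x≈) = a , x≈
      ∈⟨⟩⇒ℕ-multiple (-[1+ t ] , x≈) =
        a , ≈-trans x≈ (≈-sym (inverseʳ-unique (suc t · h) (a · h) cancels))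
        where
        -- −(t+1)·h = (t+1)(n−1)·h because n·h = ε.
        a : ℕ
        a = suc t * n ∸ suc t
        cancels : suc t · h ∙ a · h ≈ ε
        cancels = begin
          suc t · h ∙ a · h      ≈⟨ ·-homo-+ (suc t) a h ⟨
          (suc t + a) · h        ≡⟨ cong (_· h) (m+[n∸m]≡n (m≤m*n (suc t) n)) ⟩
          (suc t * n) · h        ≈⟨ ∣⇒·≈ε (n∣m*n (suc t)) ⟩
          ε                      ∎

      toParts : ∀ us → All (λ u → u ≢ [] × _∈⟨_⟩ G (σ G u) h) us → ∃ λ ps → map terms ps ≡ us
      toParts []       []                         = [] , refl
      toParts (u ∷ us) ((u≢[] , σu∈⟨h⟩) ∷ rest)
        with ps , refl ← toParts us rest
        with a , σu≈ ← ∈⟨⟩⇒ℕ-multiple σu∈⟨h⟩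
        = record { terms = u ; nonempty = u≢[] ; weight = a ; σ≈weight·h = σu≈ } ∷ ps , refl

      coarsen : ∀ k ps → k * n < length ps → ZeroSum G (flatten ps) →
                PartitionInto G (suc k) (flatten ps)
      coarsen k ps len σps≈ε
        with rest , bs , ∣bs∣ , p , rest≢[] , divisible ← divisible-blocks n weight k ps len
        = map flatten (rest ∷ bs) , cong suc (trans (length-map flatten bs) ∣bs∣) , parts↭ ,
          (flatten-≢[] rest≢[] , σrest≈ε) ∷ All.map⁺ zero-sum-blocks
        where
        parts↭ : concat (map flatten (rest ∷ bs)) ↭ flatten ps
        parts↭ = ↭-trans (↭-reflexive (concatMap-concat terms (rest ∷ bs))) (flatten-↭ p)

        zero-sum-block : ∀ {b} → b ≢ [] × n ∣ sum (map weight b) → flatten b ≢ [] × ZeroSum G (flatten b)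
        zero-sum-block {b} (b≢[] , n∣Σb) = flatten-≢[] b≢[] , ≈-trans (σ-flatten b) (∣⇒·≈ε n∣Σb)

        zero-sum-blocks : All (λ b → flatten b ≢ [] × ZeroSum G (flatten b)) bs
        zero-sum-blocks = All.map zero-sum-block divisible

        σrest≈ε : ZeroSum G (flatten rest)
        σrest≈ε = zeroSum-++⁻ˡ (flatten rest) (≈-trans (σ-↭ parts↭) σps≈ε)
          (zeroSum-concat (All.map⁺ (All.map proj₂ zero-sum-blocks)))

module _ {c ℓ c′ ℓ′ : Level} {G : AbelianGroup c ℓ} {Q : AbelianGroup c′ ℓ′}
         {h : AbelianGroup.Carrier G} {φ : AbelianGroup.Carrier G → AbelianGroup.Carrier Q}
         (epi : IsCanonicalEpi G Q h φ) where
  open AbelianGroup Q using (_≈_; ε; ∙-congˡ) renaming (sym to ≈-sym; trans to ≈-trans)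
  open IsCanonicalEpi epi using (homo; kernel)
  open GroupMorphisms.IsGroupHomomorphism homo using (⟦⟧-cong; ε-homo) renaming (homo to ∙-homo)

  σ-map : ∀ xs → σ Q (map φ xs) ≈ φ (σ G xs)
  σ-map []       = ≈-sym ε-homo
  σ-map (x ∷ xs) = ≈-trans (∙-congˡ (σ-map xs)) (≈-sym (∙-homo x (σ G xs)))

  zeroSum-map : ∀ xs → ZeroSum G xs → ZeroSum Q (map φ xs)
  zeroSum-map xs σxs≈ε = ≈-trans (σ-map xs) (≈-trans (⟦⟧-cong σxs≈ε) ε-homo)

  zeroSum-map⇒σ∈⟨h⟩ : ∀ xs → ZeroSum Q (map φ xs) → _∈⟨_⟩ G (σ G xs) h
  zeroSum-map⇒σ∈⟨h⟩ xs σφxs≈ε = Equivalence.to (kernel (σ G xs)) (≈-trans (≈-sym (σ-map xs)) σφxs≈ε)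

  nonempty-zeroSum-map⁻ : ∀ {xs} → map φ xs ≢ [] × ZeroSum Q (map φ xs) → xs ≢ [] × _∈⟨_⟩ G (σ G xs) h
  nonempty-zeroSum-map⁻ {xs} (φxs≢[] , σφxs≈ε) = φxs≢[] ∘ cong (map φ) , zeroSum-map⇒σ∈⟨h⟩ xs σφxs≈ε

lemma2p6 : {c ℓ c' ℓ' : Level} (G : AbelianGroup c ℓ) → IsFinite G →
           (h : AbelianGroup.Carrier G) (n : ℕ) → IsOrder G h n →
           (Q : AbelianGroup c' ℓ') (φ : AbelianGroup.Carrier G → AbelianGroup.Carrier Q) →
           IsCanonicalEpi G Q h φ →
           (k : ℕ) (S : List (AbelianGroup.Carrier G)) →
           𝓜 G k S → 𝓜 Q (k * n) (map φ S)
lemma2p6 G _ h n (n>0 , n·h≈ε , _) Q φ epi k S (σS≈ε , S-unsplittable) =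
  zeroSum-map epi S σS≈ε , S-unsplittable ∘ reflect
  where
  open AbelianGroup G using () renaming (trans to ≈-trans)

  instance
    nonZero-n : NonZero n
    nonZero-n = >-nonZero n>0

  reflect : PartitionInto Q (suc (k * n)) (map φ S) → PartitionInto G (suc k) S
  reflect (ts , ∣ts∣ , ts↭φS , zero-sum-ts)
    with us , refl , us↭S ← concat-↭-map-inv φ ts S ts↭φS
    with ps , refl ← toParts G h n n·h≈ε us (All.map (nonempty-zeroSum-map⁻ epi) (All.map⁻ zero-sum-ts))
    = partitionInto-resp-↭ G us↭S (coarsen G h n n·h≈ε k ps many (≈-trans (σ-↭ G us↭S) σS≈ε))
    where
    many : k * n < length ps
    many = ≤-reflexive (trans (sym ∣ts∣) (trans (length-map (map φ) (map _ ps)) (length-map _ ps)))
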